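{- The theory $\mathsf{FUTC}_1$ $\mathfrak o$-directly interprets the theory $\mathsf{FAC}^{\mathsf f+}$.
   Context: $\mathsf{FUTC}_1$ is a two-sorted theory with an object sort $\mathfrak o$ and a string sort $\mathfrak s$ (variables $x,y,\dots$ for objects, $\alpha,\beta,\dots$ for strings), a constant $\oslash$ of sort $\mathfrak s$, a unary function $[\cdot]$ from $\mathfrak o$ to $\mathfrak s$, a binary function $\star$ on $\mathfrak s$, and a function $F$ from $\mathfrak s$ to $\mathfrak o$, with axioms: $\oslash\star\alpha=\alpha\wedge\alpha\star\oslash=\alpha$; $\alpha\star\beta=\oslash\to(\alpha=\oslash\wedge\beta=\oslash)$; $(\alpha\star\beta)\star\gamma=\alpha\star(\beta\star\gamma)$; $[x]$ is an atom (i.e. $[x]\neq\oslash$ and $\alpha\star\beta=[x]\to(\alpha=\oslash\vee\beta=\oslash)$); $[x]=[y]\to x=y$; $\alpha\star\beta=\gamma\star\delta\to\exists\eta\,((\alpha\star\eta=\gamma\wedge\beta=\eta\star\delta)\vee(\alpha=\gamma\star\eta\wedge\eta\star\beta=\delta))$; $F(\alpha)=F(\beta)\to\alpha=\beta$. $\mathsf{FAC}^{\mathsf f+}$ is a two-sorted theory with an object sort $\mathfrak o$ and a class sort $\mathfrak c$ (capital letters for classes), a membership relation $\in$ between objects and classes, a constant $\emptyset$ of sort $\mathfrak c$, a singleton function $\{\cdot\}$ from $\mathfrak o$ to $\mathfrak c$, a union function $\cup$ on $\mathfrak c$, and a Frege function $F$ from $\mathfrak c$ to $\mathfrak o$, with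 axioms: $y\notin\emptyset$; $u\in\{x\}\leftrightarrow u=x$; $u\in X\cup Y\leftrightarrow(u\in X\vee u\in Y)$; $F(X)=F(Y)\to X=Y$. A translation between many-sorted languages assigns to each sort a domain formula (possibly of higher dimension) and to each symbol a formula; it is $\mathfrak o$-direct if it is one-dimensional on the object sort, sends the object sort to the object sort, has domain formula $x=x$ on it and translates object equality as object equality. An interpretation of $U$ in $V$ is a translation $\tau$ with $V\vdash\psi^\tau$ whenever $U\vdash\psi$. -}

module Defs where

open import Data.List using (List; []; _∷_; _++_; map)
open import Data.Sum using (_⊎_; inj₁; inj₂)
open import Data.Product using (Σ; _×_; _,_)
open import Data.Empty using (⊥)
open import Relation.Binary.PropositionalEquality using (_≡_; _≢_; subst)

record Signature : Set₁ where
  field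
    Sort  : Set
    Fun   : Set
    args  : Fun → List Sort
    res   : Fun → Sort
    Rel   : Set
    rargs : Rel → List Sort

infix 4 _∋_
data _∋_ {A : Set} : List A → A → Set where
  here  : ∀ {x xs} → (x ∷ xs) ∋ x
  there : ∀ {x y xs} → xs ∋ x → (y ∷ xs) ∋ x

Ren : {A : Set} → List A → List A → Set
Ren Γ Δ = ∀ {s} → Γ ∋ s → Δ ∋ s

inl : ∀ {A : Set} {Γ Δ : List A} → Ren Γ (Γ ++ Δ)
inl here      = here
inl (there x) = there (inl x)

inr : ∀ {A : Set} (Γ : List A) {Δ : List A} → Ren Δ (Γ ++ Δ)
inr []      x = x
inr (_ ∷ Γ) x = there (inr Γ x)

split : ∀ {A : Set} (Γ : List A) {Δ : List A} {s : A} → (Γ ++ Δ) ∋ s → (Γ ∋ s) ⊎ (Δ ∋ s)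
split []      x         = inj₂ x
split (_ ∷ Γ) here      = inj₁ here
split (_ ∷ Γ) (there x) with split Γ x
... | inj₁ y = inj₁ (there y)
... | inj₂ y = inj₂ y

bothR : ∀ {A : Set} {Γ Γ' Δ Δ' : List A} → Ren Γ Γ' → Ren Δ Δ' → Ren (Γ ++ Δ) (Γ' ++ Δ')
bothR {Γ = Γ} {Γ'} ρ σ x with split Γ x
... | inj₁ y = inl (ρ y)
... | inj₂ y = inr Γ' (σ y)

idR : ∀ {A : Set} {Γ : List A} → Ren Γ Γ
idR x = x

noVar : ∀ {A : Set} {Γ : List A} → Ren [] Γ
noVar ()

module Syntax (Sig : Signature) where
  open Signature Sig

  mutual
    data Term (Γ : List Sort) : Sort → Set where
      var : ∀ {s} → Γ ∋ s → Term Γ s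
      app : (f : Fun) → Terms Γ (args f) → Term Γ (res f)

    data Terms (Γ : List Sort) : List Sort → Set where
      []  : Terms Γ []
      _∷_ : ∀ {s ss} → Term Γ s → Terms Γ ss → Terms Γ (s ∷ ss)

  infix  6 _≐_
  infixr 5 _∧_
  infixr 4 _∨_
  infixr 3 _⇒_

  data Formula (Γ : List Sort) : Set where
    ⊥'  : Formula Γ
    _⇒_ : Formula Γ → Formula Γ → Formula Γ
    _∧_ : Formula Γ → Formula Γ → Formula Γ
    _∨_ : Formula Γ → Formula Γ → Formula Γ
    all : (s : Sort) → Formula (s ∷ Γ) → Formula Γ
    ex  : (s : Sort) → Formula (s ∷ Γ) → Formula Γ
    _≐_ : ∀ {s} → Term Γ s → Term Γ s → Formula Γ
    rel : (R : Rel) → Terms Γ (rargs R) → Formula Γ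

  ¬' : ∀ {Γ} → Formula Γ → Formula Γ
  ¬' φ = φ ⇒ ⊥'

  ⊤' : ∀ {Γ} → Formula Γ
  ⊤' = ⊥' ⇒ ⊥'

  ∃* : ∀ {Γ} (Δ : List Sort) → Formula (Δ ++ Γ) → Formula Γ
  ∃* []      φ = φ
  ∃* (s ∷ Δ) φ = ∃* Δ (ex s φ)

  ∀* : ∀ {Γ} (Δ : List Sort) → Formula (Δ ++ Γ) → Formula Γ
  ∀* []      φ = φ
  ∀* (s ∷ Δ) φ = ∀* Δ (all s φ)

  liftR : ∀ {Γ Δ : List Sort} {s : Sort} → Ren Γ Δ → Ren (s ∷ Γ) (s ∷ Δ)
  liftR ρ here      = here
  liftR ρ (there x) = there (ρ x)

  mutual
    renT : ∀ {Γ Δ s} → Ren Γ Δ → Term Γ s → Term Δ s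
    renT ρ (var x)    = var (ρ x)
    renT ρ (app f ts) = app f (renTs ρ ts)

    renTs : ∀ {Γ Δ ss} → Ren Γ Δ → Terms Γ ss → Terms Δ ss
    renTs ρ []       = []
    renTs ρ (t ∷ ts) = renT ρ t ∷ renTs ρ ts

  renF : ∀ {Γ Δ} → Ren Γ Δ → Formula Γ → Formula Δ
  renF ρ ⊥'        = ⊥'
  renF ρ (φ ⇒ ψ)   = renF ρ φ ⇒ renF ρ ψ
  renF ρ (φ ∧ ψ)   = renF ρ φ ∧ renF ρ ψ
  renF ρ (φ ∨ ψ)   = renF ρ φ ∨ renF ρ ψ
  renF ρ (all s φ) = all s (renF (liftR ρ) φ)
  renF ρ (ex s φ)  = ex s (renF (liftR ρ) φ)
  renF ρ (t ≐ u)   = renT ρ t ≐ renT ρ u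
  renF ρ (rel R ts) = rel R (renTs ρ ts)

  Sub : List Sort → List Sort → Set
  Sub Γ Δ = ∀ {s} → Γ ∋ s → Term Δ s

  liftS : ∀ {Γ Δ s} → Sub Γ Δ → Sub (s ∷ Γ) (s ∷ Δ)
  liftS σ here      = var here
  liftS σ (there x) = renT there (σ x)

  mutual
    subT : ∀ {Γ Δ s} → Sub Γ Δ → Term Γ s → Term Δ s
    subT σ (var x)    = σ x
    subT σ (app f ts) = app f (subTs σ ts)

    subTs : ∀ {Γ Δ ss} → Sub Γ Δ → Terms Γ ss → Terms Δ ss
    subTs σ []       = []
    subTs σ (t ∷ ts) = subT σ t ∷ subTs σ ts

  subF : ∀ {Γ Δ} → Sub Γ Δ → Formula Γ → Formula Δ
  subF σ ⊥'        = ⊥'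
  subF σ (φ ⇒ ψ)   = subF σ φ ⇒ subF σ ψ
  subF σ (φ ∧ ψ)   = subF σ φ ∧ subF σ ψ
  subF σ (φ ∨ ψ)   = subF σ φ ∨ subF σ ψ
  subF σ (all s φ) = all s (subF (liftS σ) φ)
  subF σ (ex s φ)  = ex s (subF (liftS σ) φ)
  subF σ (t ≐ u)   = subT σ t ≐ subT σ u
  subF σ (rel R ts) = rel R (subTs σ ts)

  sub1 : ∀ {Γ s} → Term Γ s → Sub (s ∷ Γ) Γ
  sub1 t here      = t
  sub1 t (there x) = var x

  _[_] : ∀ {Γ s} → Formula (s ∷ Γ) → Term Γ s → Formula Γ
  φ [ t ] = subF (sub1 t) φ

  Theory : Set₁
  Theory = Formula [] → Set

  -- Classical natural deduction, many-sorted, every sort nonempty.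
  -- Deriv T Γ Δ φ : φ is derivable from hypotheses Δ and axioms T,
  -- with free variables from Γ.
  data Deriv (T : Theory) : (Γ : List Sort) → List (Formula Γ) → Formula Γ → Set where
    axiom  : ∀ {Γ Δ φ} → T φ → Deriv T Γ Δ (renF noVar φ)
    hyp    : ∀ {Γ Δ φ} → Δ ∋ φ → Deriv T Γ Δ φ
    ⊥E     : ∀ {Γ Δ φ} → Deriv T Γ Δ ⊥' → Deriv T Γ Δ φ
    raa    : ∀ {Γ Δ φ} → Deriv T Γ (¬' φ ∷ Δ) ⊥' → Deriv T Γ Δ φ
    ⇒I     : ∀ {Γ Δ φ ψ} → Deriv T Γ (φ ∷ Δ) ψ → Deriv T Γ Δ (φ ⇒ ψ)
    ⇒E     : ∀ {Γ Δ φ ψ} → Deriv T Γ Δ (φ ⇒ ψ) → Deriv T Γ Δ φ → Deriv T Γ Δ ψ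
    ∧I     : ∀ {Γ Δ φ ψ} → Deriv T Γ Δ φ → Deriv T Γ Δ ψ → Deriv T Γ Δ (φ ∧ ψ)
    ∧E₁    : ∀ {Γ Δ φ ψ} → Deriv T Γ Δ (φ ∧ ψ) → Deriv T Γ Δ φ
    ∧E₂    : ∀ {Γ Δ φ ψ} → Deriv T Γ Δ (φ ∧ ψ) → Deriv T Γ Δ ψ
    ∨I₁    : ∀ {Γ Δ φ ψ} → Deriv T Γ Δ φ → Deriv T Γ Δ (φ ∨ ψ)
    ∨I₂    : ∀ {Γ Δ φ ψ} → Deriv T Γ Δ ψ → Deriv T Γ Δ (φ ∨ ψ)
    ∨E     : ∀ {Γ Δ φ ψ χ} → Deriv T Γ Δ (φ ∨ ψ) → Deriv T Γ (φ ∷ Δ) χ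
             → Deriv T Γ (ψ ∷ Δ) χ → Deriv T Γ Δ χ
    ∀I     : ∀ {Γ Δ s φ} → Deriv T (s ∷ Γ) (map (renF there) Δ) φ → Deriv T Γ Δ (all s φ)
    ∀E     : ∀ {Γ Δ s φ} → Deriv T Γ Δ (all s φ) → (t : Term Γ s) → Deriv T Γ Δ (φ [ t ])
    ∃I     : ∀ {Γ Δ s φ} → (t : Term Γ s) → Deriv T Γ Δ (φ [ t ]) → Deriv T Γ Δ (ex s φ)
    ∃E     : ∀ {Γ Δ s φ ψ} → Deriv T Γ Δ (ex s φ)
             → Deriv T (s ∷ Γ) (φ ∷ map (renF there) Δ) (renF there ψ) → Deriv T Γ Δ ψ
    ≐refl  : ∀ {Γ Δ s} (t : Term Γ s) → Deriv T Γ Δ (t ≐ t)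
    ≐subst : ∀ {Γ Δ s} {t u : Term Γ s} (φ : Formula (s ∷ Γ))
             → Deriv T Γ Δ (t ≐ u) → Deriv T Γ Δ (φ [ t ]) → Deriv T Γ Δ (φ [ u ])
    nonempty : ∀ {Γ Δ} (s : Sort) → Deriv T Γ Δ (ex s (var here ≐ var here))

  _⊢_ : Theory → Formula [] → Set
  T ⊢ φ = Deriv T [] [] φ

module Translations (U V : Signature) where
  private
    module SU = Signature U
    module SV = Signature V
  module U = Syntax U
  module V = Syntax V
  open V using (_≐_; _∧_; _⇒_; ⊤'; ∃*; ∀*; renF; var)

  blocks : (SU.Sort → List SV.Sort) → List SU.Sort → List SV.Sort
  blocks d []      = []
  blocks d (s ∷ Γ) = d s ++ blocks d Γ

  record Translation : Set where
    field
      sorts     : SU.Sort → List SV.Sort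
      sorts-pos : ∀ s → sorts s ≢ []
      dom       : (s : SU.Sort) → V.Formula (sorts s)
      eqτ       : (s : SU.Sort) → V.Formula (blocks sorts (s ∷ s ∷ []))
      funτ      : (f : SU.Fun) → V.Formula (blocks sorts (SU.args f) ++ sorts (SU.res f))
                   -- F(x̄₁,…,x̄ₙ, ȳ)  ("f(x₁,…,xₙ) = y")
      relτ      : (R : SU.Rel) → V.Formula (blocks sorts (SU.rargs R))

  module Translate (τ : Translation) where
    open Translation τ

    bl : List SU.Sort → List SV.Sort
    bl = blocks sorts

    block : ∀ {Γ s} → Γ ∋ s → Ren (sorts s) (bl Γ)
    block here          y = inl y
    block {s' ∷ Γ} (there x) y = inr (sorts s') (block x y)

    idEqs : ∀ {Θ} (Δ : List SV.Sort) → Ren Δ Θ → Ren Δ Θ → V.Formula Θ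
    idEqs []      ρ σ = ⊤'
    idEqs (t ∷ Δ) ρ σ = (var (ρ here) ≐ var (σ here)) ∧ idEqs Δ (λ x → ρ (there x)) (λ x → σ (there x))

    mutual
      -- trTerm t : "ȳ (first block) is the value of t"
      trTerm : ∀ {Γ s} → U.Term Γ s → V.Formula (sorts s ++ bl Γ)
      trTerm {Γ} {s} (U.var x) = idEqs (sorts s) inl (λ i → inr (sorts s) (block x i))
      trTerm {Γ} (U.app f ts) =
        ∃* (bl (SU.args f))
           (renF (bothR {Γ = bl (SU.args f)} {Γ' = bl (SU.args f)} idR (inr (sorts (SU.res f)))) (trTerms ts)
            ∧ renF (bothR {Γ = bl (SU.args f)} {Γ' = bl (SU.args f)} idR inl) (funτ f))

      trTerms : ∀ {Γ ss} → U.Terms Γ ss → V.Formula (bl ss ++ bl Γ)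
      trTerms U.[] = ⊤'
      trTerms {Γ} {s ∷ ss} (t U.∷ ts) =
        renF (λ i → inl (inl i)) (dom s)
        ∧ (renF (bothR {Γ = sorts s} {Γ' = sorts s ++ bl ss} inl idR) (trTerm t)
        ∧ renF (bothR {Γ = bl ss} {Γ' = sorts s ++ bl ss} (inr (sorts s)) idR) (trTerms ts))

    trF : ∀ {Γ} → U.Formula Γ → V.Formula (bl Γ)
    trF U.⊥'          = V.⊥'
    trF (φ U.⇒ ψ)     = trF φ V.⇒ trF ψ
    trF (φ U.∧ ψ)     = trF φ V.∧ trF ψ
    trF (φ U.∨ ψ)     = trF φ V.∨ trF ψ
    trF (U.all s φ)   = ∀* (sorts s) (renF inl (dom s) V.⇒ trF φ)
    trF (U.ex s φ)    = ∃* (sorts s) (renF inl (dom s) V.∧ trF φ)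
    trF (U._≐_ {s} t u) =
      ∃* (bl (s ∷ s ∷ [])) (trTerms (t U.∷ (u U.∷ U.[])) V.∧ renF inl (eqτ s))
    trF (U.rel R ts)  = ∃* (bl (SU.rargs R)) (trTerms ts V.∧ renF inl (relτ R))

  IsInterpretation : Translation → U.Theory → V.Theory → Set
  IsInterpretation τ TU TV =
    ∀ (ψ : U.Formula []) → U._⊢_ TU ψ → V._⊢_ TV (Translate.trF τ ψ)

data FUTCSort : Set where
  𝔬 𝔰 : FUTCSort

data FUTCFun : Set where
  ⊘f brk star frege : FUTCFun

futcArgs : FUTCFun → List FUTCSort
futcArgs ⊘f    = []
futcArgs brk   = 𝔬 ∷ []
futcArgs star  = 𝔰 ∷ 𝔰 ∷ []
futcArgs frege = 𝔰 ∷ []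

futcRes : FUTCFun → FUTCSort
futcRes ⊘f    = 𝔰
futcRes brk   = 𝔰
futcRes star  = 𝔰
futcRes frege = 𝔬

noRel : ⊥ → List FUTCSort
noRel ()

FUTCSig : Signature
FUTCSig = record { Sort = FUTCSort ; Fun = FUTCFun ; args = futcArgs ; res = futcRes
                 ; Rel = ⊥ ; rargs = noRel }

module FUTC where
  open Syntax FUTCSig public

  v0 : ∀ {Γ a} → Term (a ∷ Γ) a
  v0 = var here
  v1 : ∀ {Γ a b} → Term (b ∷ a ∷ Γ) a
  v1 = var (there here)
  v2 : ∀ {Γ a b c} → Term (c ∷ b ∷ a ∷ Γ) a
  v2 = var (there (there here))
  v3 : ∀ {Γ a b c d} → Term (d ∷ c ∷ b ∷ a ∷ Γ) a
  v3 = var (there (there (there here)))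
  v4 : ∀ {Γ a b c d e} → Term (e ∷ d ∷ c ∷ b ∷ a ∷ Γ) a
  v4 = var (there (there (there (there here))))

  ⊘ : ∀ {Γ} → Term Γ 𝔰
  ⊘ = app ⊘f []

  [_] : ∀ {Γ} → Term Γ 𝔬 → Term Γ 𝔰
  [ x ] = app brk (x ∷ [])

  infixl 8 _⋆_
  _⋆_ : ∀ {Γ} → Term Γ 𝔰 → Term Γ 𝔰 → Term Γ 𝔰
  a ⋆ b = app star (a ∷ (b ∷ []))

  F : ∀ {Γ} → Term Γ 𝔰 → Term Γ 𝔬
  F a = app frege (a ∷ [])

  -- axioms (universal closures); de Bruijn: v0 = innermost bound variable
  data Ax : Formula [] → Set where
    unit  : Ax (all 𝔰 ((⊘ ⋆ v0 ≐ v0) ∧ (v0 ⋆ ⊘ ≐ v0)))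
    nozd  : Ax (all 𝔰 (all 𝔰 ((v1 ⋆ v0 ≐ ⊘) ⇒ ((v1 ≐ ⊘) ∧ (v0 ≐ ⊘)))))
    assoc : Ax (all 𝔰 (all 𝔰 (all 𝔰 ((v2 ⋆ v1) ⋆ v0 ≐ v2 ⋆ (v1 ⋆ v0)))))
    atom  : Ax (all 𝔬 (¬' ([ v0 ] ≐ ⊘)
                 ∧ all 𝔰 (all 𝔰 ((v1 ⋆ v0 ≐ [ v2 ]) ⇒ ((v1 ≐ ⊘) ∨ (v0 ≐ ⊘))))))
    brkinj : Ax (all 𝔬 (all 𝔬 (([ v1 ] ≐ [ v0 ]) ⇒ (v1 ≐ v0))))
    editor : Ax (all 𝔰 (all 𝔰 (all 𝔰 (all 𝔰 ((v3 ⋆ v2 ≐ v1 ⋆ v0) ⇒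
               ex 𝔰 (((v4 ⋆ v0 ≐ v2) ∧ (v3 ≐ v0 ⋆ v1))
                     ∨ ((v4 ≐ v2 ⋆ v0) ∧ (v0 ⋆ v3 ≐ v1))))))))
    finj  : Ax (all 𝔰 (all 𝔰 ((F v1 ≐ F v0) ⇒ (v1 ≐ v0))))

data FACSort : Set where
  𝔬 𝔠 : FACSort

data FACFun : Set where
  ∅f sing uni frege : FACFun

facArgs : FACFun → List FACSort
facArgs ∅f    = []
facArgs sing  = 𝔬 ∷ []
facArgs uni   = 𝔠 ∷ 𝔠 ∷ []
facArgs frege = 𝔠 ∷ []

facRes : FACFun → FACSort
facRes ∅f    = 𝔠
facRes sing  = 𝔠
facRes uni   = 𝔠
facRes frege = 𝔬

data FACRel : Set where
  mem : FACRel

facRArgs : FACRel → List FACSort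
facRArgs mem = 𝔬 ∷ 𝔠 ∷ []

FACSig : Signature
FACSig = record { Sort = FACSort ; Fun = FACFun ; args = facArgs ; res = facRes
                ; Rel = FACRel ; rargs = facRArgs }

module FAC where
  open Syntax FACSig public

  v0 : ∀ {Γ a} → Term (a ∷ Γ) a
  v0 = var here
  v1 : ∀ {Γ a b} → Term (b ∷ a ∷ Γ) a
  v1 = var (there here)
  v2 : ∀ {Γ a b c} → Term (c ∷ b ∷ a ∷ Γ) a
  v2 = var (there (there here))

  ∅ : ∀ {Γ} → Term Γ 𝔠
  ∅ = app ∅f []

  ⟦_⟧ : ∀ {Γ} → Term Γ 𝔬 → Term Γ 𝔠
  ⟦ x ⟧ = app sing (x ∷ [])

  infixl 8 _∪_
  _∪_ : ∀ {Γ} → Term Γ 𝔠 → Term Γ 𝔠 → Term Γ 𝔠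
  X ∪ Y = app uni (X ∷ (Y ∷ []))

  F : ∀ {Γ} → Term Γ 𝔠 → Term Γ 𝔬
  F X = app frege (X ∷ [])

  infix 6 _∈'_
  _∈'_ : ∀ {Γ} → Term Γ 𝔬 → Term Γ 𝔠 → Formula Γ
  x ∈' X = rel mem (x ∷ (X ∷ []))

  data Ax : Formula [] → Set where
    empty : Ax (all 𝔬 (¬' (v0 ∈' ∅)))
    -- u ∈ {x} ↔ u = x   (x = v1, u = v0)
    single : Ax (all 𝔬 (all 𝔬 (((v0 ∈' ⟦ v1 ⟧) ⇒ (v0 ≐ v1)) ∧ ((v0 ≐ v1) ⇒ (v0 ∈' ⟦ v1 ⟧)))))
    -- u ∈ X ∪ Y ↔ (u ∈ X ∨ u ∈ Y)   (X = v2, Y = v1, u = v0)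
    union : Ax (all 𝔠 (all 𝔠 (all 𝔬 (((v0 ∈' v2 ∪ v1) ⇒ ((v0 ∈' v2) ∨ (v0 ∈' v1)))
                                 ∧ (((v0 ∈' v2) ∨ (v0 ∈' v1)) ⇒ (v0 ∈' v2 ∪ v1))))))
    finj  : Ax (all 𝔠 (all 𝔠 ((F v1 ≐ F v0) ⇒ (v1 ≐ v0))))

open Translations FACSig FUTCSig public
  using (Translation; IsInterpretation; blocks)

IsODirect : Translation → Set
IsODirect τ =
  Σ (sorts 𝔬 ≡ 𝔬 ∷ []) λ p →
      (subst FUTC.Formula p (dom 𝔬) ≡ (FUTC.var here FUTC.≐ FUTC.var here))
    × (subst (λ Δ → FUTC.Formula (Δ ++ (Δ ++ []))) p (eqτ 𝔬)
         ≡ (FUTC.var here FUTC.≐ FUTC.var (there here)))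
  where open Translation τ

ODirectlyInterprets-FUTC-FAC : Set
ODirectlyInterprets-FUTC-FAC =
  Σ Translation λ τ → IsODirect τ × IsInterpretation τ FAC.Ax FUTC.Ax

-- Classes are interpreted by strings: ∅ by ⊘, {x} by [x], X ∪ Y by X ⋆ Y, and u ∈ X by
-- u occurs-in X, i.e. X = α ⋆ [u] ⋆ β. Class equality is string equality, so the Frege
-- axiom of FAC^{f+} becomes that of FUTC₁. The other class axioms become facts about strings:
-- ⊘ has no occurrences because ⊘ is conical; an occurrence in the atom [x] is x itself by
-- irreducibility and injectivity of [·]; and an occurrence in α ⋆ β lies in α or in β by
-- equidivisibility (the editor axiom), applied once to locate the occurrence relative to the
-- cut and once more to decide on which side of the cut the atom itself lies. Since every
-- symbol is translated by a term, the relational translation of a formula is provably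
-- equivalent to plain substitution of these terms, and substitution commutes with derivations.
module Submission where

open import Defs
open import Data.List using (List; []; _∷_; _++_; map)
open import Data.Product using (Σ; _×_; _,_)
open import Data.List.Properties using (map-∘; map-cong)
open import Relation.Binary.PropositionalEquality
  using (_≡_; refl; sym; trans; cong; cong₂; subst; subst₂)

module SyntaxProperties (Sig : Signature) where
  open Signature Sig
  open Syntax Sig

  wkT : ∀ {Γ s a} → Term Γ a → Term (s ∷ Γ) a
  wkT = renT there

  wkF : ∀ {Γ s} → Formula Γ → Formula (s ∷ Γ)
  wkF = renF there

  infixr 5 _∷ₛ_
  _∷ₛ_ : ∀ {Γ Δ s} → Term Δ s → Sub Γ Δ → Sub (s ∷ Γ) Δ
  (t ∷ₛ σ) here      = t
  (t ∷ₛ σ) (there x) = σ x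

  liftR-liftR : ∀ {Γ Δ Θ s} {ρ : Ren Δ Θ} {ρ′ : Ren Γ Δ} {ρ″ : Ren Γ Θ}
    → (∀ {a} (x : Γ ∋ a) → ρ (ρ′ x) ≡ ρ″ x)
    → ∀ {a} (x : (s ∷ Γ) ∋ a) → liftR ρ (liftR ρ′ x) ≡ liftR ρ″ x
  liftR-liftR h here      = refl
  liftR-liftR h (there x) = cong there (h x)

  mutual
    renT-renT : ∀ {Γ Δ Θ s} {ρ : Ren Δ Θ} {ρ′ : Ren Γ Δ} {ρ″ : Ren Γ Θ}
      → (∀ {a} (x : Γ ∋ a) → ρ (ρ′ x) ≡ ρ″ x)
      → (t : Term Γ s) → renT ρ (renT ρ′ t) ≡ renT ρ″ t
    renT-renT h (var x)    = cong var (h x)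
    renT-renT h (app f ts) = cong (app f) (renTs-renTs h ts)

    renTs-renTs : ∀ {Γ Δ Θ ss} {ρ : Ren Δ Θ} {ρ′ : Ren Γ Δ} {ρ″ : Ren Γ Θ}
      → (∀ {a} (x : Γ ∋ a) → ρ (ρ′ x) ≡ ρ″ x)
      → (ts : Terms Γ ss) → renTs ρ (renTs ρ′ ts) ≡ renTs ρ″ ts
    renTs-renTs h []       = refl
    renTs-renTs h (t ∷ ts) = cong₂ _∷_ (renT-renT h t) (renTs-renTs h ts)

  renF-renF : ∀ {Γ Δ Θ} {ρ : Ren Δ Θ} {ρ′ : Ren Γ Δ} {ρ″ : Ren Γ Θ}
    → (∀ {a} (x : Γ ∋ a) → ρ (ρ′ x) ≡ ρ″ x)
    → (φ : Formula Γ) → renF ρ (renF ρ′ φ) ≡ renF ρ″ φ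
  renF-renF h ⊥'         = refl
  renF-renF h (φ ⇒ ψ)    = cong₂ _⇒_ (renF-renF h φ) (renF-renF h ψ)
  renF-renF h (φ ∧ ψ)    = cong₂ _∧_ (renF-renF h φ) (renF-renF h ψ)
  renF-renF h (φ ∨ ψ)    = cong₂ _∨_ (renF-renF h φ) (renF-renF h ψ)
  renF-renF h (all s φ)  = cong (all s) (renF-renF (liftR-liftR h) φ)
  renF-renF h (ex s φ)   = cong (ex s) (renF-renF (liftR-liftR h) φ)
  renF-renF h (t ≐ u)    = cong₂ _≐_ (renT-renT h t) (renT-renT h u)
  renF-renF h (rel R ts) = cong (rel R) (renTs-renTs h ts)

  liftS-liftR : ∀ {Γ Δ Θ s} {σ : Sub Δ Θ} {ρ : Ren Γ Δ} {σ′ : Sub Γ Θ}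
    → (∀ {a} (x : Γ ∋ a) → σ (ρ x) ≡ σ′ x)
    → ∀ {a} (x : (s ∷ Γ) ∋ a) → liftS σ (liftR ρ x) ≡ liftS σ′ x
  liftS-liftR h here      = refl
  liftS-liftR h (there x) = cong wkT (h x)

  mutual
    subT-renT : ∀ {Γ Δ Θ s} {σ : Sub Δ Θ} {ρ : Ren Γ Δ} {σ′ : Sub Γ Θ}
      → (∀ {a} (x : Γ ∋ a) → σ (ρ x) ≡ σ′ x)
      → (t : Term Γ s) → subT σ (renT ρ t) ≡ subT σ′ t
    subT-renT h (var x)    = h x
    subT-renT h (app f ts) = cong (app f) (subTs-renTs h ts)

    subTs-renTs : ∀ {Γ Δ Θ ss} {σ : Sub Δ Θ} {ρ : Ren Γ Δ} {σ′ : Sub Γ Θ}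
      → (∀ {a} (x : Γ ∋ a) → σ (ρ x) ≡ σ′ x)
      → (ts : Terms Γ ss) → subTs σ (renTs ρ ts) ≡ subTs σ′ ts
    subTs-renTs h []       = refl
    subTs-renTs h (t ∷ ts) = cong₂ _∷_ (subT-renT h t) (subTs-renTs h ts)

  subF-renF : ∀ {Γ Δ Θ} {σ : Sub Δ Θ} {ρ : Ren Γ Δ} {σ′ : Sub Γ Θ}
    → (∀ {a} (x : Γ ∋ a) → σ (ρ x) ≡ σ′ x)
    → (φ : Formula Γ) → subF σ (renF ρ φ) ≡ subF σ′ φ
  subF-renF h ⊥'         = refl
  subF-renF h (φ ⇒ ψ)    = cong₂ _⇒_ (subF-renF h φ) (subF-renF h ψ)
  subF-renF h (φ ∧ ψ)    = cong₂ _∧_ (subF-renF h φ) (subF-renF h ψ)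
  subF-renF h (φ ∨ ψ)    = cong₂ _∨_ (subF-renF h φ) (subF-renF h ψ)
  subF-renF h (all s φ)  = cong (all s) (subF-renF (liftS-liftR h) φ)
  subF-renF h (ex s φ)   = cong (ex s) (subF-renF (liftS-liftR h) φ)
  subF-renF h (t ≐ u)    = cong₂ _≐_ (subT-renT h t) (subT-renT h u)
  subF-renF h (rel R ts) = cong (rel R) (subTs-renTs h ts)

  liftR-liftS : ∀ {Γ Δ Θ s} {ρ : Ren Δ Θ} {σ : Sub Γ Δ} {σ′ : Sub Γ Θ}
    → (∀ {a} (x : Γ ∋ a) → renT ρ (σ x) ≡ σ′ x)
    → ∀ {a} (x : (s ∷ Γ) ∋ a) → renT (liftR ρ) (liftS σ x) ≡ liftS σ′ x
  liftR-liftS h here = refl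
  liftR-liftS {σ = σ} h (there x) =
    trans (renT-renT (λ _ → refl) (σ x))
          (trans (sym (renT-renT (λ _ → refl) (σ x))) (cong wkT (h x)))

  mutual
    renT-subT : ∀ {Γ Δ Θ s} {ρ : Ren Δ Θ} {σ : Sub Γ Δ} {σ′ : Sub Γ Θ}
      → (∀ {a} (x : Γ ∋ a) → renT ρ (σ x) ≡ σ′ x)
      → (t : Term Γ s) → renT ρ (subT σ t) ≡ subT σ′ t
    renT-subT h (var x)    = h x
    renT-subT h (app f ts) = cong (app f) (renTs-subTs h ts)

    renTs-subTs : ∀ {Γ Δ Θ ss} {ρ : Ren Δ Θ} {σ : Sub Γ Δ} {σ′ : Sub Γ Θ}
      → (∀ {a} (x : Γ ∋ a) → renT ρ (σ x) ≡ σ′ x)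
      → (ts : Terms Γ ss) → renTs ρ (subTs σ ts) ≡ subTs σ′ ts
    renTs-subTs h []       = refl
    renTs-subTs h (t ∷ ts) = cong₂ _∷_ (renT-subT h t) (renTs-subTs h ts)

  renF-subF : ∀ {Γ Δ Θ} {ρ : Ren Δ Θ} {σ : Sub Γ Δ} {σ′ : Sub Γ Θ}
    → (∀ {a} (x : Γ ∋ a) → renT ρ (σ x) ≡ σ′ x)
    → (φ : Formula Γ) → renF ρ (subF σ φ) ≡ subF σ′ φ
  renF-subF h ⊥'         = refl
  renF-subF h (φ ⇒ ψ)    = cong₂ _⇒_ (renF-subF h φ) (renF-subF h ψ)
  renF-subF h (φ ∧ ψ)    = cong₂ _∧_ (renF-subF h φ) (renF-subF h ψ)
  renF-subF h (φ ∨ ψ)    = cong₂ _∨_ (renF-subF h φ) (renF-subF h ψ)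
  renF-subF h (all s φ)  = cong (all s) (renF-subF (liftR-liftS h) φ)
  renF-subF h (ex s φ)   = cong (ex s) (renF-subF (liftR-liftS h) φ)
  renF-subF h (t ≐ u)    = cong₂ _≐_ (renT-subT h t) (renT-subT h u)
  renF-subF h (rel R ts) = cong (rel R) (renTs-subTs h ts)

  liftS-liftS : ∀ {Γ Δ Θ s} {σ : Sub Δ Θ} {σ′ : Sub Γ Δ} {σ″ : Sub Γ Θ}
    → (∀ {a} (x : Γ ∋ a) → subT σ (σ′ x) ≡ σ″ x)
    → ∀ {a} (x : (s ∷ Γ) ∋ a) → subT (liftS σ) (liftS σ′ x) ≡ liftS σ″ x
  liftS-liftS h here = refl
  liftS-liftS {σ′ = σ′} h (there x) =
    trans (subT-renT (λ _ → refl) (σ′ x))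
          (trans (sym (renT-subT (λ _ → refl) (σ′ x))) (cong wkT (h x)))

  mutual
    subT-subT : ∀ {Γ Δ Θ s} {σ : Sub Δ Θ} {σ′ : Sub Γ Δ} {σ″ : Sub Γ Θ}
      → (∀ {a} (x : Γ ∋ a) → subT σ (σ′ x) ≡ σ″ x)
      → (t : Term Γ s) → subT σ (subT σ′ t) ≡ subT σ″ t
    subT-subT h (var x)    = h x
    subT-subT h (app f ts) = cong (app f) (subTs-subTs h ts)

    subTs-subTs : ∀ {Γ Δ Θ ss} {σ : Sub Δ Θ} {σ′ : Sub Γ Δ} {σ″ : Sub Γ Θ}
      → (∀ {a} (x : Γ ∋ a) → subT σ (σ′ x) ≡ σ″ x)
      → (ts : Terms Γ ss) → subTs σ (subTs σ′ ts) ≡ subTs σ″ ts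
    subTs-subTs h []       = refl
    subTs-subTs h (t ∷ ts) = cong₂ _∷_ (subT-subT h t) (subTs-subTs h ts)

  subF-subF : ∀ {Γ Δ Θ} {σ : Sub Δ Θ} {σ′ : Sub Γ Δ} {σ″ : Sub Γ Θ}
    → (∀ {a} (x : Γ ∋ a) → subT σ (σ′ x) ≡ σ″ x)
    → (φ : Formula Γ) → subF σ (subF σ′ φ) ≡ subF σ″ φ
  subF-subF h ⊥'         = refl
  subF-subF h (φ ⇒ ψ)    = cong₂ _⇒_ (subF-subF h φ) (subF-subF h ψ)
  subF-subF h (φ ∧ ψ)    = cong₂ _∧_ (subF-subF h φ) (subF-subF h ψ)
  subF-subF h (φ ∨ ψ)    = cong₂ _∨_ (subF-subF h φ) (subF-subF h ψ)
  subF-subF h (all s φ)  = cong (all s) (subF-subF (liftS-liftS h) φ)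
  subF-subF h (ex s φ)   = cong (ex s) (subF-subF (liftS-liftS h) φ)
  subF-subF h (t ≐ u)    = cong₂ _≐_ (subT-subT h t) (subT-subT h u)
  subF-subF h (rel R ts) = cong (rel R) (subTs-subTs h ts)

  liftS-var : ∀ {Γ s} {σ : Sub Γ Γ} → (∀ {a} (x : Γ ∋ a) → σ x ≡ var x)
    → ∀ {a} (x : (s ∷ Γ) ∋ a) → liftS σ x ≡ var x
  liftS-var h here      = refl
  liftS-var h (there x) = cong wkT (h x)

  mutual
    subT-var : ∀ {Γ s} {σ : Sub Γ Γ} → (∀ {a} (x : Γ ∋ a) → σ x ≡ var x)
      → (t : Term Γ s) → subT σ t ≡ t
    subT-var h (var x)    = h x
    subT-var h (app f ts) = cong (app f) (subTs-var h ts)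

    subTs-var : ∀ {Γ ss} {σ : Sub Γ Γ} → (∀ {a} (x : Γ ∋ a) → σ x ≡ var x)
      → (ts : Terms Γ ss) → subTs σ ts ≡ ts
    subTs-var h []       = refl
    subTs-var h (t ∷ ts) = cong₂ _∷_ (subT-var h t) (subTs-var h ts)

  subF-var : ∀ {Γ} {σ : Sub Γ Γ} → (∀ {a} (x : Γ ∋ a) → σ x ≡ var x)
    → (φ : Formula Γ) → subF σ φ ≡ φ
  subF-var h ⊥'         = refl
  subF-var h (φ ⇒ ψ)    = cong₂ _⇒_ (subF-var h φ) (subF-var h ψ)
  subF-var h (φ ∧ ψ)    = cong₂ _∧_ (subF-var h φ) (subF-var h ψ)
  subF-var h (φ ∨ ψ)    = cong₂ _∨_ (subF-var h φ) (subF-var h ψ)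
  subF-var h (all s φ)  = cong (all s) (subF-var (liftS-var h) φ)
  subF-var h (ex s φ)   = cong (ex s) (subF-var (liftS-var h) φ)
  subF-var h (t ≐ u)    = cong₂ _≐_ (subT-var h t) (subT-var h u)
  subF-var h (rel R ts) = cong (rel R) (subTs-var h ts)

  renT-∘ : ∀ {Γ Δ Θ s} {ρ : Ren Δ Θ} {ρ′ : Ren Γ Δ} (t : Term Γ s)
    → renT ρ (renT ρ′ t) ≡ renT (λ x → ρ (ρ′ x)) t
  renT-∘ = renT-renT (λ _ → refl)

  renF-∘ : ∀ {Γ Δ Θ} {ρ : Ren Δ Θ} {ρ′ : Ren Γ Δ} (φ : Formula Γ)
    → renF ρ (renF ρ′ φ) ≡ renF (λ x → ρ (ρ′ x)) φ
  renF-∘ = renF-renF (λ _ → refl)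

  renT-∘₃ : ∀ {Γ Δ Θ Ξ s} {ρ₁ : Ren Θ Ξ} {ρ₂ : Ren Δ Θ} {ρ₃ : Ren Γ Δ} (t : Term Γ s)
    → renT ρ₁ (renT ρ₂ (renT ρ₃ t)) ≡ renT (λ x → ρ₁ (ρ₂ (ρ₃ x))) t
  renT-∘₃ t = trans (cong (renT _) (renT-∘ t)) (renT-∘ t)

  renF-∘₃ : ∀ {Γ Δ Θ Ξ} {ρ₁ : Ren Θ Ξ} {ρ₂ : Ren Δ Θ} {ρ₃ : Ren Γ Δ} (φ : Formula Γ)
    → renF ρ₁ (renF ρ₂ (renF ρ₃ φ)) ≡ renF (λ x → ρ₁ (ρ₂ (ρ₃ x))) φ
  renF-∘₃ φ = trans (cong (renF _) (renF-∘ φ)) (renF-∘ φ)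

  sub1-wkT : ∀ {Γ s a} (u : Term Γ s) (t : Term Γ a) → subT (sub1 u) (wkT t) ≡ t
  sub1-wkT u t = trans (subT-renT (λ _ → refl) t) (subT-var (λ _ → refl) t)

  subF-wkF : ∀ {Γ Δ s} (σ : Sub Γ Δ) (φ : Formula Γ)
    → subF (liftS {s = s} σ) (wkF φ) ≡ wkF (subF σ φ)
  subF-wkF σ φ = trans (subF-renF (λ _ → refl) φ) (sym (renF-subF (λ _ → refl) φ))

  subF-[] : ∀ {Γ Δ s} (σ : Sub Γ Δ) (φ : Formula (s ∷ Γ)) (t : Term Γ s)
    → subF σ (φ [ t ]) ≡ subF (liftS σ) φ [ subT σ t ]
  subF-[] σ φ t = trans (subF-subF pointwise φ) (sym (subF-subF (λ _ → refl) φ))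
    where
    pointwise : ∀ {a} (x : (_ ∷ _) ∋ a) → subT σ (sub1 t x) ≡ subT (sub1 (subT σ t)) (liftS σ x)
    pointwise here      = refl
    pointwise (there x) = sym (sub1-wkT (subT σ t) (σ x))

  subF-closed : ∀ {Γ Δ} (σ : Sub Γ Δ) (φ : Formula []) → subF σ (renF noVar φ) ≡ renF noVar φ
  subF-closed σ φ =
    trans (subF-renF {σ′ = noSub} (λ ()) φ)
          (sym (trans (sym (subF-var (λ _ → refl) (renF noVar φ))) (subF-renF (λ ()) φ)))
    where
    noSub : Sub [] _
    noSub ()

  liftWk-[v0] : ∀ {Γ s} (φ : Formula (s ∷ Γ)) → renF (liftR there) φ [ var here ] ≡ φ
  liftWk-[v0] φ =
    trans (subF-renF {σ′ = var} (λ { here → refl ; (there x) → refl }) φ) (subF-var (λ _ → refl) φ)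

  liftWk-[wkT] : ∀ {Γ s b} (φ : Formula (s ∷ Γ)) (a : Term Γ s)
    → renF (liftR (there {y = b})) φ [ wkT a ] ≡ wkF (φ [ a ])
  liftWk-[wkT] φ a =
    trans (subF-renF {σ′ = λ x → wkT (sub1 a x)} (λ { here → refl ; (there x) → refl }) φ)
          (sym (renF-subF (λ _ → refl) φ))

  [wkT]-[] : ∀ {Γ s₁ s₂} (φ : Formula (s₁ ∷ s₂ ∷ Γ)) (a₁ : Term Γ s₁) (a₂ : Term Γ s₂)
    → (φ [ wkT a₁ ]) [ a₂ ] ≡ subF (a₁ ∷ₛ a₂ ∷ₛ var) φ
  [wkT]-[] φ a₁ a₂ =
    subF-subF (λ { here → sub1-wkT a₂ a₁ ; (there here) → refl ; (there (there x)) → refl }) φ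

  liftS-[]-[] : ∀ {Γ s₁ s₂} (φ : Formula (s₁ ∷ s₂ ∷ Γ)) (a₁ : Term Γ s₁) (a₂ : Term Γ s₂)
    → subF (liftS (sub1 a₂)) φ [ a₁ ] ≡ subF (a₁ ∷ₛ a₂ ∷ₛ var) φ
  liftS-[]-[] φ a₁ a₂ =
    subF-subF (λ { here → refl ; (there here) → sub1-wkT a₁ a₂ ; (there (there x)) → refl }) φ

∋-map⁺ : ∀ {A B : Set} {f : A → B} {xs : List A} {x} → xs ∋ x → map f xs ∋ f x
∋-map⁺ here      = here
∋-map⁺ (there p) = there (∋-map⁺ p)

∋-map⁻ : ∀ {A B : Set} {f : A → B} (xs : List A) {y}
  → map f xs ∋ y → Σ A (λ x → (xs ∋ x) × (y ≡ f x))
∋-map⁻ (x ∷ xs) here = x , here , refl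
∋-map⁻ (x ∷ xs) (there p) with ∋-map⁻ xs p
... | z , q , eq = z , there q , eq

infix 4 _⊆_
_⊆_ : ∀ {A : Set} → List A → List A → Set
xs ⊆ ys = ∀ {x} → xs ∋ x → ys ∋ x

∷⁺-⊆ : ∀ {A : Set} {xs ys : List A} {x} → xs ⊆ ys → x ∷ xs ⊆ x ∷ ys
∷⁺-⊆ p here      = here
∷⁺-⊆ p (there q) = there (p q)

map⁺-⊆ : ∀ {A B : Set} {f : A → B} {xs ys : List A} → xs ⊆ ys → map f xs ⊆ map f ys
map⁺-⊆ {xs = xs} p q with ∋-map⁻ xs q
... | _ , r , refl = ∋-map⁺ (p r)

module DerivationProperties (Sig : Signature) (T : Syntax.Theory Sig) where
  open Signature Sig
  open Syntax Sig
  open SyntaxProperties Sig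

  weaken : ∀ {Γ Δ Δ′ φ} → Δ ⊆ Δ′ → Deriv T Γ Δ φ → Deriv T Γ Δ′ φ
  weaken p (axiom ax)     = axiom ax
  weaken p (hyp x)        = hyp (p x)
  weaken p (⊥E d)         = ⊥E (weaken p d)
  weaken p (raa d)        = raa (weaken (∷⁺-⊆ p) d)
  weaken p (⇒I d)         = ⇒I (weaken (∷⁺-⊆ p) d)
  weaken p (⇒E d e)       = ⇒E (weaken p d) (weaken p e)
  weaken p (∧I d e)       = ∧I (weaken p d) (weaken p e)
  weaken p (∧E₁ d)        = ∧E₁ (weaken p d)
  weaken p (∧E₂ d)        = ∧E₂ (weaken p d)
  weaken p (∨I₁ d)        = ∨I₁ (weaken p d)
  weaken p (∨I₂ d)        = ∨I₂ (weaken p d)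
  weaken p (∨E d e f)     = ∨E (weaken p d) (weaken (∷⁺-⊆ p) e) (weaken (∷⁺-⊆ p) f)
  weaken p (∀I d)         = ∀I (weaken (map⁺-⊆ p) d)
  weaken p (∀E d t)       = ∀E (weaken p d) t
  weaken p (∃I t d)       = ∃I t (weaken p d)
  weaken p (∃E d e)       = ∃E (weaken p d) (weaken (∷⁺-⊆ (map⁺-⊆ p)) e)
  weaken p (≐refl t)      = ≐refl t
  weaken p (≐subst φ d e) = ≐subst φ (weaken p d) (weaken p e)
  weaken p (nonempty s)   = nonempty s

  map-subF-wkF : ∀ {Γ Δ s} (σ : Sub Γ Δ) (Φ : List (Formula Γ))
    → map (subF (liftS {s = s} σ)) (map wkF Φ) ≡ map wkF (map (subF σ) Φ)
  map-subF-wkF σ Φ = trans (sym (map-∘ Φ)) (trans (map-cong (subF-wkF σ) Φ) (map-∘ Φ))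

  sub-Deriv : ∀ {Γ Θ Δ φ} (σ : Sub Γ Θ) → Deriv T Γ Δ φ → Deriv T Θ (map (subF σ) Δ) (subF σ φ)
  sub-Deriv σ (axiom {φ = φ} ax) = subst (Deriv T _ _) (sym (subF-closed σ φ)) (axiom ax)
  sub-Deriv σ (hyp x)            = hyp (∋-map⁺ x)
  sub-Deriv σ (⊥E d)             = ⊥E (sub-Deriv σ d)
  sub-Deriv σ (raa d)            = raa (sub-Deriv σ d)
  sub-Deriv σ (⇒I d)             = ⇒I (sub-Deriv σ d)
  sub-Deriv σ (⇒E d e)           = ⇒E (sub-Deriv σ d) (sub-Deriv σ e)
  sub-Deriv σ (∧I d e)           = ∧I (sub-Deriv σ d) (sub-Deriv σ e)
  sub-Deriv σ (∧E₁ d)            = ∧E₁ (sub-Deriv σ d)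
  sub-Deriv σ (∧E₂ d)            = ∧E₂ (sub-Deriv σ d)
  sub-Deriv σ (∨I₁ d)            = ∨I₁ (sub-Deriv σ d)
  sub-Deriv σ (∨I₂ d)            = ∨I₂ (sub-Deriv σ d)
  sub-Deriv σ (∨E d e f)         = ∨E (sub-Deriv σ d) (sub-Deriv σ e) (sub-Deriv σ f)
  sub-Deriv σ (∀I {Δ = Δ} d) =
    ∀I (subst (λ Δ′ → Deriv T _ Δ′ _) (map-subF-wkF σ Δ) (sub-Deriv (liftS σ) d))
  sub-Deriv σ (∀E {φ = φ} d t) =
    subst (Deriv T _ _) (sym (subF-[] σ φ t)) (∀E (sub-Deriv σ d) (subT σ t))
  sub-Deriv σ (∃I {φ = φ} t d) =
    ∃I (subT σ t) (subst (Deriv T _ _) (subF-[] σ φ t) (sub-Deriv σ d))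
  sub-Deriv σ (∃E {Δ = Δ} {φ = φ} {ψ = ψ} d e) =
    ∃E (sub-Deriv σ d)
       (subst₂ (λ Δ′ χ → Deriv T _ (subF (liftS σ) φ ∷ Δ′) χ) (map-subF-wkF σ Δ) (subF-wkF σ ψ)
               (sub-Deriv (liftS σ) e))
  sub-Deriv σ (≐refl t)          = ≐refl (subT σ t)
  sub-Deriv σ (≐subst {t = t} {u} φ d e) =
    subst (Deriv T _ _) (sym (subF-[] σ φ u))
      (≐subst (subF (liftS σ) φ) (sub-Deriv σ d) (subst (Deriv T _ _) (subF-[] σ φ t) (sub-Deriv σ e)))
  sub-Deriv σ (nonempty s)       = nonempty s

  instantiate : ∀ {Γ Θ Δ φ} (σ : Sub Γ Θ) → Deriv T Γ [] φ → Deriv T Θ Δ (subF σ φ)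
  instantiate σ d = weaken (λ ()) (sub-Deriv σ d)

  ≡⇒≐ : ∀ {Γ Δ s} {t u : Term Γ s} → t ≡ u → Deriv T Γ Δ (t ≐ u)
  ≡⇒≐ {t = t} refl = ≐refl t

  ≐-sym : ∀ {Γ Δ s} {a b : Term Γ s} → Deriv T Γ Δ (a ≐ b) → Deriv T Γ Δ (b ≐ a)
  ≐-sym {a = a} {b} d =
    subst (λ c → Deriv T _ _ (b ≐ c)) (sub1-wkT b a)
      (≐subst (var here ≐ wkT a) d (≡⇒≐ (sym (sub1-wkT a a))))

  infixr 5 _⟫_
  _⟫_ : ∀ {Γ Δ s} {a b c : Term Γ s} → Deriv T Γ Δ (a ≐ b) → Deriv T Γ Δ (b ≐ c) → Deriv T Γ Δ (a ≐ c)
  _⟫_ {a = a} {b} {c} d e =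
    subst (λ x → Deriv T _ _ (x ≐ c)) (sub1-wkT c a)
      (≐subst (wkT a ≐ var here) e (subst (λ x → Deriv T _ _ (x ≐ b)) (sym (sub1-wkT b a)) d))

  ≐-cong : ∀ {Γ Δ s s′} {a b : Term Γ s} (C : Term (s ∷ Γ) s′)
    → Deriv T Γ Δ (a ≐ b) → Deriv T Γ Δ (subT (sub1 a) C ≐ subT (sub1 b) C)
  ≐-cong {a = a} {b} C d =
    subst (λ x → Deriv T _ _ (x ≐ subT (sub1 b) C)) (sub1-wkT b (subT (sub1 a) C))
      (≐subst (wkT (subT (sub1 a) C) ≐ C) d (≡⇒≐ (sub1-wkT a (subT (sub1 a) C))))

  ex-elim-at : ∀ {Γ Δ s} {φ ψ : Formula (s ∷ Γ)} (a : Term Γ s)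
    → Deriv T Γ Δ (ex s φ)
    → Deriv T (s ∷ Γ) [] (φ ⇒ var here ≐ wkT a)
    → Deriv T (s ∷ Γ) [] (φ ⇒ ψ)
    → Deriv T Γ Δ (ψ [ a ])
  ex-elim-at {ψ = ψ} a d e g =
    ∃E d (subst (Deriv T _ _) (liftWk-[wkT] ψ a)
           (≐subst (renF (liftR there) ψ) (⇒E (weaken (λ ()) e) (hyp here))
             (subst (Deriv T _ _) (sym (liftWk-[v0] ψ)) (⇒E (weaken (λ ()) g) (hyp here)))))

  ex-intro-at : ∀ {Γ Δ s} {φ ψ : Formula (s ∷ Γ)} (a : Term Γ s)
    → Deriv T Γ Δ (ψ [ a ])
    → Deriv T (s ∷ Γ) [] (var here ≐ wkT a ⇒ ψ ⇒ φ)
    → Deriv T Γ Δ (ex s φ)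
  ex-intro-at a d g = ∃I a (⇒E (⇒E (instantiate (sub1 a) g) (≡⇒≐ (sym (sub1-wkT a a)))) d)

  ex₂-elim-at : ∀ {Γ Δ s₁ s₂} {φ ψ : Formula (s₁ ∷ s₂ ∷ Γ)} (a₁ : Term Γ s₁) (a₂ : Term Γ s₂)
    → Deriv T Γ Δ (ex s₂ (ex s₁ φ))
    → Deriv T (s₁ ∷ s₂ ∷ Γ) [] (φ ⇒ var here ≐ wkT (wkT a₁))
    → Deriv T (s₁ ∷ s₂ ∷ Γ) [] (φ ⇒ var (there here) ≐ wkT (wkT a₂))
    → Deriv T (s₁ ∷ s₂ ∷ Γ) [] (φ ⇒ ψ)
    → Deriv T Γ Δ (subF (a₁ ∷ₛ a₂ ∷ₛ var) ψ)
  ex₂-elim-at {ψ = ψ} a₁ a₂ d e₁ e₂ g =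
    subst (Deriv T _ _) ([wkT]-[] ψ a₁ a₂)
      (ex-elim-at a₂ d (⇒I (∃E (hyp here) (⇒E (weaken (λ ()) e₂) (hyp here))))
                       (⇒I (ex-elim-at (wkT a₁) (hyp here) e₁ g)))

  ex₂-intro-at : ∀ {Γ Δ s₁ s₂} {φ ψ : Formula (s₁ ∷ s₂ ∷ Γ)} (a₁ : Term Γ s₁) (a₂ : Term Γ s₂)
    → Deriv T Γ Δ (subF (a₁ ∷ₛ a₂ ∷ₛ var) ψ)
    → Deriv T (s₁ ∷ s₂ ∷ Γ) []
        (var here ≐ wkT (wkT a₁) ⇒ var (there here) ≐ wkT (wkT a₂) ⇒ ψ ⇒ φ)
    → Deriv T Γ Δ (ex s₂ (ex s₁ φ))
  ex₂-intro-at {φ = φ} a₁ a₂ d g =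
    ∃I a₂ (∃I a₁ (subst (Deriv T _ _) (sym (liftS-[]-[] φ a₁ a₂))
      (⇒E (⇒E (⇒E (instantiate (a₁ ∷ₛ a₂ ∷ₛ var) g) (≡⇒≐ (sym (wk₂-vanishes a₁))))
                                                   (≡⇒≐ (sym (wk₂-vanishes a₂))))
          d)))
    where
    wk₂-vanishes : ∀ {a} (t : Term _ a) → subT (a₁ ∷ₛ a₂ ∷ₛ var) (wkT (wkT t)) ≡ t
    wk₂-vanishes t = trans (subT-renT (λ _ → refl) (wkT t))
                           (trans (subT-renT (λ _ → refl) t) (subT-var (λ _ → refl) t))

open FUTC hiding (_[_])
open SyntaxProperties FUTCSig
open DerivationProperties FUTCSig Ax

-- ∀E at a non-variable term leaves substitutions stuck on weakened terms, so facts with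
-- several variables are derived at variables and then instantiated.

⋆-identityˡ : ∀ {Θ Δ} (α : Term Θ 𝔰) → Deriv Ax Θ Δ (⊘ ⋆ α ≐ α)
⋆-identityˡ α = ∧E₁ (∀E (axiom unit) α)

⋆-identityʳ : ∀ {Θ Δ} (α : Term Θ 𝔰) → Deriv Ax Θ Δ (α ⋆ ⊘ ≐ α)
⋆-identityʳ α = ∧E₂ (∀E (axiom unit) α)

⋆-assoc : ∀ {Θ Δ} (α β γ : Term Θ 𝔰) → Deriv Ax Θ Δ ((α ⋆ β) ⋆ γ ≐ α ⋆ (β ⋆ γ))
⋆-assoc α β γ = instantiate (γ ∷ₛ β ∷ₛ α ∷ₛ var) (∀E (∀E (∀E (axiom assoc) v2) v1) v0)

⋆-conical : ∀ {Θ Δ} {α β : Term Θ 𝔰} → Deriv Ax Θ Δ (α ⋆ β ≐ ⊘) → Deriv Ax Θ Δ ((α ≐ ⊘) ∧ (β ≐ ⊘))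
⋆-conical {α = α} {β} = ⇒E (instantiate (β ∷ₛ α ∷ₛ var) (∀E (∀E (axiom nozd) v1) v0))

⋆-equidivisible : ∀ {Θ Δ} {α β γ δ : Term Θ 𝔰} → Deriv Ax Θ Δ (α ⋆ β ≐ γ ⋆ δ)
  → Deriv Ax Θ Δ (ex 𝔰 ((wkT α ⋆ v0 ≐ wkT γ) ∧ (wkT β ≐ v0 ⋆ wkT δ)
                     ∨ (wkT α ≐ wkT γ ⋆ v0) ∧ (v0 ⋆ wkT β ≐ wkT δ)))
⋆-equidivisible {α = α} {β} {γ} {δ} =
  ⇒E (instantiate (δ ∷ₛ γ ∷ₛ β ∷ₛ α ∷ₛ var) (∀E (∀E (∀E (∀E (axiom editor) v3) v2) v1) v0))

[]≢⊘ : ∀ {Θ Δ} {x : Term Θ 𝔬} → Deriv Ax Θ Δ ([ x ] ≐ ⊘) → Deriv Ax Θ Δ ⊥'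
[]≢⊘ {x = x} = ⇒E (∧E₁ (∀E (axiom atom) x))

[]-irreducible : ∀ {Θ Δ} {x : Term Θ 𝔬} {α β : Term Θ 𝔰}
  → Deriv Ax Θ Δ (α ⋆ β ≐ [ x ]) → Deriv Ax Θ Δ ((α ≐ ⊘) ∨ (β ≐ ⊘))
[]-irreducible {x = x} {α} {β} =
  ⇒E (instantiate (β ∷ₛ α ∷ₛ x ∷ₛ var) (∀E (∀E (∧E₂ (∀E (axiom atom) v2)) v1) v0))

[]-injective : ∀ {Θ Δ} {x y : Term Θ 𝔬} → Deriv Ax Θ Δ ([ x ] ≐ [ y ]) → Deriv Ax Θ Δ (x ≐ y)
[]-injective {x = x} {y} = ⇒E (instantiate (y ∷ₛ x ∷ₛ var) (∀E (∀E (axiom brkinj) v1) v0))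

⋆-congˡ : ∀ {Θ Δ} {α β : Term Θ 𝔰} (γ : Term Θ 𝔰)
  → Deriv Ax Θ Δ (α ≐ β) → Deriv Ax Θ Δ (γ ⋆ α ≐ γ ⋆ β)
⋆-congˡ {α = α} {β} γ d =
  subst₂ (λ p q → Deriv Ax _ _ (p ⋆ α ≐ q ⋆ β)) (sub1-wkT α γ) (sub1-wkT β γ) (≐-cong (wkT γ ⋆ v0) d)

⋆-congʳ : ∀ {Θ Δ} {α β : Term Θ 𝔰} (γ : Term Θ 𝔰)
  → Deriv Ax Θ Δ (α ≐ β) → Deriv Ax Θ Δ (α ⋆ γ ≐ β ⋆ γ)
⋆-congʳ {α = α} {β} γ d =
  subst₂ (λ p q → Deriv Ax _ _ (α ⋆ p ≐ β ⋆ q)) (sub1-wkT α γ) (sub1-wkT β γ) (≐-cong (v0 ⋆ wkT γ) d)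

[]-cong : ∀ {Θ Δ} {x y : Term Θ 𝔬} → Deriv Ax Θ Δ (x ≐ y) → Deriv Ax Θ Δ ([ x ] ≐ [ y ])
[]-cong = ≐-cong [ v0 ]

⋆-identityˡ-≐ : ∀ {Θ Δ} {α β : Term Θ 𝔰} → Deriv Ax Θ Δ (α ≐ ⊘) → Deriv Ax Θ Δ (α ⋆ β ≐ β)
⋆-identityˡ-≐ {β = β} e = ⋆-congʳ β e ⟫ ⋆-identityˡ β

⋆-identityʳ-≐ : ∀ {Θ Δ} {α β : Term Θ 𝔰} → Deriv Ax Θ Δ (β ≐ ⊘) → Deriv Ax Θ Δ (α ⋆ β ≐ α)
⋆-identityʳ-≐ {α = α} e = ⋆-congˡ α e ⟫ ⋆-identityʳ α

infix 6 _occurs-in_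
_occurs-in_ : ∀ {Θ} → Term Θ 𝔬 → Term Θ 𝔰 → Formula Θ
x occurs-in α = ex 𝔰 (ex 𝔰 (wkT (wkT α) ≐ v1 ⋆ ([ wkT (wkT x) ] ⋆ v0)))

renF-occurs-in : ∀ {Θ Θ′} (ρ : Ren Θ Θ′) (x : Term Θ 𝔬) (α : Term Θ 𝔰)
  → renF ρ (x occurs-in α) ≡ renT ρ x occurs-in renT ρ α
renF-occurs-in ρ x α = cong₂ (λ a b → ex 𝔰 (ex 𝔰 (b ≐ v1 ⋆ ([ a ] ⋆ v0)))) (wk₂-renT x) (wk₂-renT α)
  where
  wk₂-renT : ∀ {s} (t : Term _ s)
    → renT (liftR (liftR ρ)) (wkT (wkT t)) ≡ wkT {s = 𝔰} (wkT {s = 𝔰} (renT ρ t))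
  wk₂-renT t = trans (renT-∘ (wkT t)) (trans (renT-∘ t) (sym (trans (cong wkT (renT-∘ t)) (renT-∘ t))))

subF-occurs-in : ∀ {Θ Θ′} (σ : Sub Θ Θ′) (x : Term Θ 𝔬) (α : Term Θ 𝔰)
  → subF σ (x occurs-in α) ≡ subT σ x occurs-in subT σ α
subF-occurs-in σ x α = cong₂ (λ a b → ex 𝔰 (ex 𝔰 (b ≐ v1 ⋆ ([ a ] ⋆ v0)))) (wk₂-subT x) (wk₂-subT α)
  where
  wk₂-subT : ∀ {s} (t : Term _ s)
    → subT (liftS (liftS σ)) (wkT (wkT t)) ≡ wkT {s = 𝔰} (wkT {s = 𝔰} (subT σ t))
  wk₂-subT t = trans (subT-renT (λ _ → refl) (wkT t))
    (trans (subT-renT (λ _ → refl) t)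
      (sym (trans (cong wkT (renT-subT (λ _ → refl) t)) (renT-subT (λ _ → refl) t))))

occurs-in-intro : ∀ {Θ Δ} {x : Term Θ 𝔬} {α β γ : Term Θ 𝔰}
  → Deriv Ax Θ Δ (α ≐ β ⋆ ([ x ] ⋆ γ)) → Deriv Ax Θ Δ (x occurs-in α)
occurs-in-intro {x = x} {α} {β} {γ} = ⇒E (instantiate (γ ∷ₛ β ∷ₛ x ∷ₛ α ∷ₛ var) generic)
  where
  generic : ∀ {Θ} → Deriv Ax (𝔰 ∷ 𝔰 ∷ 𝔬 ∷ 𝔰 ∷ Θ) [] (v3 ≐ v1 ⋆ ([ v2 ] ⋆ v0) ⇒ v2 occurs-in v3)
  generic = ⇒I (∃I v1 (∃I v0 (hyp here)))

occurs-in-resp-≐ : ∀ {Θ Δ} {x : Term Θ 𝔬} {α β : Term Θ 𝔰}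
  → Deriv Ax Θ Δ (α ≐ β) → Deriv Ax Θ Δ (x occurs-in α) → Deriv Ax Θ Δ (x occurs-in β)
occurs-in-resp-≐ {x = x} {α} {β} e d = ⇒E (⇒E (instantiate (x ∷ₛ β ∷ₛ α ∷ₛ var) generic) e) d
  where
  generic : ∀ {Θ} → Deriv Ax (𝔬 ∷ 𝔰 ∷ 𝔰 ∷ Θ) [] (v2 ≐ v1 ⇒ v0 occurs-in v2 ⇒ v0 occurs-in v1)
  generic = ⇒I (⇒I (≐subst (v1 occurs-in v0) (hyp (there here)) (hyp here)))

occurs-in-[] : ∀ {Θ Δ} (x : Term Θ 𝔬) → Deriv Ax Θ Δ (x occurs-in [ x ])
occurs-in-[] x = occurs-in-intro (≐-sym (⋆-identityˡ _ ⟫ ⋆-identityʳ _))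

≐[]⇒occurs-in : ∀ {Θ Δ} {x : Term Θ 𝔬} {α : Term Θ 𝔰}
  → Deriv Ax Θ Δ (α ≐ [ x ]) → Deriv Ax Θ Δ (x occurs-in α)
≐[]⇒occurs-in {x = x} e = occurs-in-resp-≐ (≐-sym e) (occurs-in-[] x)

occurs-in-⋆ˡ : ∀ {Θ Δ} {x : Term Θ 𝔬} {α β : Term Θ 𝔰}
  → Deriv Ax Θ Δ (x occurs-in α) → Deriv Ax Θ Δ (x occurs-in (α ⋆ β))
occurs-in-⋆ˡ {x = x} {α} {β} = ⇒E (instantiate (x ∷ₛ β ∷ₛ α ∷ₛ var) generic)
  where
  generic : ∀ {Θ} → Deriv Ax (𝔬 ∷ 𝔰 ∷ 𝔰 ∷ Θ) [] (v0 occurs-in v2 ⇒ v0 occurs-in (v2 ⋆ v1))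
  generic = ⇒I (∃E (hyp here) (∃E (hyp here) (occurs-in-intro
    (⋆-congʳ v3 (hyp here) ⟫ ⋆-assoc _ _ _ ⟫ ⋆-congˡ v1 (⋆-assoc _ _ _)))))

occurs-in-⋆ʳ : ∀ {Θ Δ} {x : Term Θ 𝔬} {α β : Term Θ 𝔰}
  → Deriv Ax Θ Δ (x occurs-in β) → Deriv Ax Θ Δ (x occurs-in (α ⋆ β))
occurs-in-⋆ʳ {x = x} {α} {β} = ⇒E (instantiate (x ∷ₛ β ∷ₛ α ∷ₛ var) generic)
  where
  generic : ∀ {Θ} → Deriv Ax (𝔬 ∷ 𝔰 ∷ 𝔰 ∷ Θ) [] (v0 occurs-in v1 ⇒ v0 occurs-in (v2 ⋆ v1))
  generic = ⇒I (∃E (hyp here) (∃E (hyp here) (occurs-in-intro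
    (⋆-congˡ v4 (hyp here) ⟫ ≐-sym (⋆-assoc _ _ _)))))

⊘≢⋆[]⋆ : ∀ {Θ Δ} {x : Term Θ 𝔬} {α β : Term Θ 𝔰}
  → Deriv Ax Θ Δ (⊘ ≐ α ⋆ ([ x ] ⋆ β)) → Deriv Ax Θ Δ ⊥'
⊘≢⋆[]⋆ e = []≢⊘ (∧E₁ (⋆-conical (∧E₂ (⋆-conical (≐-sym e)))))

[]≐[]⋆⇒≐ : ∀ {Θ Δ} {x y : Term Θ 𝔬} {β : Term Θ 𝔰}
  → Deriv Ax Θ Δ ([ x ] ≐ [ y ] ⋆ β) → Deriv Ax Θ Δ (y ≐ x)
[]≐[]⋆⇒≐ e =
  ∨E ([]-irreducible (≐-sym e))
     (⊥E ([]≢⊘ (hyp here)))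
     (≐-sym ([]-injective (weaken there e ⟫ ⋆-identityʳ-≐ (hyp here))))

[]≐⋆[]⋆⇒≐ : ∀ {Θ Δ} {x y : Term Θ 𝔬} {α β : Term Θ 𝔰}
  → Deriv Ax Θ Δ ([ x ] ≐ α ⋆ ([ y ] ⋆ β)) → Deriv Ax Θ Δ (y ≐ x)
[]≐⋆[]⋆⇒≐ e =
  ∨E ([]-irreducible (≐-sym e))
     ([]≐[]⋆⇒≐ (weaken there e ⟫ ⋆-identityˡ-≐ (hyp here)))
     (⊥E ([]≢⊘ (∧E₁ (⋆-conical (hyp here)))))

¬occurs-in-⊘ : ∀ {Θ Δ} {x : Term Θ 𝔬} → Deriv Ax Θ Δ (x occurs-in ⊘) → Deriv Ax Θ Δ ⊥'
¬occurs-in-⊘ d = ∃E d (∃E (hyp here) (⊘≢⋆[]⋆ (hyp here)))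

occurs-in-[]⁻ : ∀ {Θ Δ} {x y : Term Θ 𝔬} → Deriv Ax Θ Δ (y occurs-in [ x ]) → Deriv Ax Θ Δ (y ≐ x)
occurs-in-[]⁻ d = ∃E d (∃E (hyp here) ([]≐⋆[]⋆⇒≐ (hyp here)))

-- Equidivisibility gives α = [x] ⋆ θ, or α ⋆ θ = [x] and β = θ ⋆ γ; in the latter case the
-- atom [x] is α or θ.
head-occurs-in-⋆ : ∀ {Θ Δ} {x : Term Θ 𝔬} {α β γ : Term Θ 𝔰}
  → Deriv Ax Θ Δ (α ⋆ β ≐ [ x ] ⋆ γ) → Deriv Ax Θ Δ (x occurs-in α ∨ x occurs-in β)
head-occurs-in-⋆ {x = x} {α} {β} {γ} = ⇒E (instantiate (γ ∷ₛ x ∷ₛ β ∷ₛ α ∷ₛ var) generic)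
  where
  generic : ∀ {Θ} → Deriv Ax (𝔰 ∷ 𝔬 ∷ 𝔰 ∷ 𝔰 ∷ Θ) []
    (v3 ⋆ v2 ≐ [ v1 ] ⋆ v0 ⇒ v1 occurs-in v3 ∨ v1 occurs-in v2)
  generic = ⇒I (∃E (⋆-equidivisible (hyp here)) (∨E (hyp here)
    (∨E ([]-irreducible (∧E₁ (hyp here)))
        (∨I₂ (occurs-in-intro (∧E₂ (hyp (there here))
          ⟫ ⋆-congʳ v1 (≐-sym (⋆-identityˡ-≐ (hyp here)) ⟫ ∧E₁ (hyp (there here)))
          ⟫ ≐-sym (⋆-identityˡ _))))
        (∨I₁ (≐[]⇒occurs-in (≐-sym (⋆-identityʳ-≐ (hyp here)) ⟫ ∧E₁ (hyp (there here))))))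
    (∨I₁ (occurs-in-intro (∧E₁ (hyp here) ⟫ ≐-sym (⋆-identityˡ _))))))

-- Equidivisibility applied to α ⋆ β = γ ⋆ ([x] ⋆ δ) puts [x] inside β, or leaves a piece η
-- with α = γ ⋆ η and η ⋆ β = [x] ⋆ δ.
occurs-in-⋆⁻ : ∀ {Θ Δ} {x : Term Θ 𝔬} {α β : Term Θ 𝔰}
  → Deriv Ax Θ Δ (x occurs-in (α ⋆ β)) → Deriv Ax Θ Δ (x occurs-in α ∨ x occurs-in β)
occurs-in-⋆⁻ {x = x} {α} {β} = ⇒E (instantiate (x ∷ₛ β ∷ₛ α ∷ₛ var) generic)
  where
  generic : ∀ {Θ} → Deriv Ax (𝔬 ∷ 𝔰 ∷ 𝔰 ∷ Θ) [] (v0 occurs-in (v2 ⋆ v1) ⇒ v0 occurs-in v2 ∨ v0 occurs-in v1)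
  generic = ⇒I (∃E (hyp here) (∃E (hyp here) (∃E (⋆-equidivisible (hyp here)) (∨E (hyp here)
    (∨I₂ (occurs-in-intro (∧E₂ (hyp here))))
    (∨E (head-occurs-in-⋆ (∧E₂ (hyp here)))
        (∨I₁ (occurs-in-resp-≐ (≐-sym (∧E₁ (hyp (there here)))) (occurs-in-⋆ʳ (hyp here))))
        (∨I₂ (hyp here)))))))

open Translations FACSig FUTCSig using (module Translate)

trSort : FACSort → FUTCSort
trSort 𝔬 = 𝔬
trSort 𝔠 = 𝔰

trSorts : FACSort → List FUTCSort
trSorts s = trSort s ∷ []

trFun : (f : FACFun) → Formula (blocks trSorts (facArgs f) ++ trSorts (facRes f))
trFun ∅f    = v0 ≐ ⊘
trFun sing  = v1 ≐ [ v0 ]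
trFun uni   = v2 ≐ v0 ⋆ v1
trFun frege = v1 ≐ F v0

trRel : (R : FACRel) → Formula (blocks trSorts (facRArgs R))
trRel mem = v0 occurs-in v1

τ : Translation
τ = record
  { sorts     = trSorts
  ; sorts-pos = λ s ()
  ; dom       = λ s → v0 ≐ v0
  ; eqτ       = λ s → v0 ≐ v1
  ; funτ      = trFun
  ; relτ      = trRel
  }

τ-oDirect : IsODirect τ
τ-oDirect = refl , refl , refl

open Translate τ

directT : ∀ {Γ s} → FAC.Term Γ s → Term (bl Γ) (trSort s)
directT (FAC.var x)                                  = var (block x here)
directT (FAC.app ∅f FAC.[])                          = ⊘
directT (FAC.app sing (x FAC.∷ FAC.[]))              = [ directT x ]
directT (FAC.app uni (X FAC.∷ (Y FAC.∷ FAC.[])))     = directT X ⋆ directT Y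
directT (FAC.app frege (X FAC.∷ FAC.[]))             = F (directT X)

directF : ∀ {Γ} → FAC.Formula Γ → Formula (bl Γ)
directF FAC.⊥'                                      = ⊥'
directF (φ FAC.⇒ ψ)                                 = directF φ ⇒ directF ψ
directF (φ FAC.∧ ψ)                                 = directF φ ∧ directF ψ
directF (φ FAC.∨ ψ)                                 = directF φ ∨ directF ψ
directF (FAC.all s φ)                               = all (trSort s) (directF φ)
directF (FAC.ex s φ)                                = ex (trSort s) (directF φ)
directF (t FAC.≐ u)                                 = directT t ≐ directT u
directF (FAC.rel mem (x FAC.∷ (X FAC.∷ FAC.[])))    = directT x occurs-in directT X

TracksRen : ∀ {Γ Δ} → Ren Γ Δ → Ren (bl Γ) (bl Δ) → Set
TracksRen {Γ} ρ ρ′ = ∀ {a} (x : Γ ∋ a) → ρ′ (block x here) ≡ block (ρ x) here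

TracksRen-liftR : ∀ {Γ Δ s} {ρ : Ren Γ Δ} {ρ′ : Ren (bl Γ) (bl Δ)}
  → TracksRen ρ ρ′ → TracksRen {s ∷ Γ} (FAC.liftR ρ) (liftR ρ′)
TracksRen-liftR h here      = refl
TracksRen-liftR h (there x) = cong there (h x)

directT-renT : ∀ {Γ Δ s} {ρ : Ren Γ Δ} {ρ′ : Ren (bl Γ) (bl Δ)} → TracksRen ρ ρ′
  → (t : FAC.Term Γ s) → directT (FAC.renT ρ t) ≡ renT ρ′ (directT t)
directT-renT h (FAC.var x)                              = cong var (sym (h x))
directT-renT h (FAC.app ∅f FAC.[])                      = refl
directT-renT h (FAC.app sing (x FAC.∷ FAC.[]))          = cong [_] (directT-renT h x)
directT-renT h (FAC.app uni (X FAC.∷ (Y FAC.∷ FAC.[]))) = cong₂ _⋆_ (directT-renT h X) (directT-renT h Y)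
directT-renT h (FAC.app frege (X FAC.∷ FAC.[]))         = cong F (directT-renT h X)

directF-renF : ∀ {Γ Δ} {ρ : Ren Γ Δ} {ρ′ : Ren (bl Γ) (bl Δ)} → TracksRen ρ ρ′
  → (φ : FAC.Formula Γ) → directF (FAC.renF ρ φ) ≡ renF ρ′ (directF φ)
directF-renF h FAC.⊥'          = refl
directF-renF h (φ FAC.⇒ ψ)     = cong₂ _⇒_ (directF-renF h φ) (directF-renF h ψ)
directF-renF h (φ FAC.∧ ψ)     = cong₂ _∧_ (directF-renF h φ) (directF-renF h ψ)
directF-renF h (φ FAC.∨ ψ)     = cong₂ _∨_ (directF-renF h φ) (directF-renF h ψ)
directF-renF h (FAC.all s φ)   = cong (all (trSort s)) (directF-renF (TracksRen-liftR h) φ)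
directF-renF h (FAC.ex s φ)    = cong (ex (trSort s)) (directF-renF (TracksRen-liftR h) φ)
directF-renF h (t FAC.≐ u)     = cong₂ _≐_ (directT-renT h t) (directT-renT h u)
directF-renF {ρ′ = ρ′} h (FAC.rel mem (x FAC.∷ (X FAC.∷ FAC.[]))) =
  trans (cong₂ _occurs-in_ (directT-renT h x) (directT-renT h X))
        (sym (renF-occurs-in ρ′ (directT x) (directT X)))

TracksSub : ∀ {Γ Δ} → FAC.Sub Γ Δ → Sub (bl Γ) (bl Δ) → Set
TracksSub {Γ} σ σ′ = ∀ {a} (x : Γ ∋ a) → σ′ (block x here) ≡ directT (σ x)

TracksSub-liftS : ∀ {Γ Δ s} {σ : FAC.Sub Γ Δ} {σ′ : Sub (bl Γ) (bl Δ)}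
  → TracksSub σ σ′ → TracksSub {s ∷ Γ} (FAC.liftS σ) (liftS σ′)
TracksSub-liftS h here = refl
TracksSub-liftS {σ = σ} h (there x) = trans (cong wkT (h x)) (sym (directT-renT (λ _ → refl) (σ x)))

directT-subT : ∀ {Γ Δ s} {σ : FAC.Sub Γ Δ} {σ′ : Sub (bl Γ) (bl Δ)} → TracksSub σ σ′
  → (t : FAC.Term Γ s) → directT (FAC.subT σ t) ≡ subT σ′ (directT t)
directT-subT h (FAC.var x)                              = sym (h x)
directT-subT h (FAC.app ∅f FAC.[])                      = refl
directT-subT h (FAC.app sing (x FAC.∷ FAC.[]))          = cong [_] (directT-subT h x)
directT-subT h (FAC.app uni (X FAC.∷ (Y FAC.∷ FAC.[]))) = cong₂ _⋆_ (directT-subT h X) (directT-subT h Y)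
directT-subT h (FAC.app frege (X FAC.∷ FAC.[]))         = cong F (directT-subT h X)

directF-subF : ∀ {Γ Δ} {σ : FAC.Sub Γ Δ} {σ′ : Sub (bl Γ) (bl Δ)} → TracksSub σ σ′
  → (φ : FAC.Formula Γ) → directF (FAC.subF σ φ) ≡ subF σ′ (directF φ)
directF-subF h FAC.⊥'          = refl
directF-subF h (φ FAC.⇒ ψ)     = cong₂ _⇒_ (directF-subF h φ) (directF-subF h ψ)
directF-subF h (φ FAC.∧ ψ)     = cong₂ _∧_ (directF-subF h φ) (directF-subF h ψ)
directF-subF h (φ FAC.∨ ψ)     = cong₂ _∨_ (directF-subF h φ) (directF-subF h ψ)
directF-subF h (FAC.all s φ)   = cong (all (trSort s)) (directF-subF (TracksSub-liftS h) φ)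
directF-subF h (FAC.ex s φ)    = cong (ex (trSort s)) (directF-subF (TracksSub-liftS h) φ)
directF-subF h (t FAC.≐ u)     = cong₂ _≐_ (directT-subT h t) (directT-subT h u)
directF-subF {σ′ = σ′} h (FAC.rel mem (x FAC.∷ (X FAC.∷ FAC.[]))) =
  trans (cong₂ _occurs-in_ (directT-subT h x) (directT-subT h X))
        (sym (subF-occurs-in σ′ (directT x) (directT X)))

directF-[] : ∀ {Γ s} (φ : FAC.Formula (s ∷ Γ)) (t : FAC.Term Γ s)
  → directF (FAC._[_] φ t) ≡ subF (sub1 (directT t)) (directF φ)
directF-[] φ t = directF-subF (λ { here → refl ; (there x) → refl }) φ

directF-wkF : ∀ {Γ s} (φ : FAC.Formula Γ) → directF (FAC.renF (there {y = s}) φ) ≡ wkF (directF φ)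
directF-wkF = directF-renF (λ _ → refl)

map-directF-wkF : ∀ {Γ s} (Φ : List (FAC.Formula Γ))
  → map directF (map (FAC.renF (there {y = s})) Φ) ≡ map wkF (map directF Φ)
map-directF-wkF Φ = trans (sym (map-∘ Φ)) (trans (map-cong directF-wkF Φ) (map-∘ Φ))

directF-closed : ∀ {Γ} (φ : FAC.Formula []) → directF (FAC.renF (noVar {Γ = Γ}) φ) ≡ renF noVar (directF φ)
directF-closed = directF-renF (λ ())

directF-axiom : ∀ {Θ Δ φ} → FAC.Ax φ → Deriv Ax Θ Δ (renF noVar (directF φ))
directF-axiom FAC.empty  = ∀I (⇒I (¬occurs-in-⊘ (hyp here)))
directF-axiom FAC.single = ∀I (∀I (∧I
  (⇒I (occurs-in-[]⁻ (hyp here)))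
  (⇒I (≐[]⇒occurs-in ([]-cong (≐-sym (hyp here)))))))
directF-axiom FAC.union  = ∀I (∀I (∀I (∧I
  (⇒I (occurs-in-⋆⁻ (hyp here)))
  (⇒I (∨E (hyp here) (occurs-in-⋆ˡ (hyp here)) (occurs-in-⋆ʳ (hyp here)))))))
directF-axiom FAC.finj   = axiom finj

directF-sound : ∀ {Γ Δ φ} → FAC.Deriv FAC.Ax Γ Δ φ → Deriv Ax (bl Γ) (map directF Δ) (directF φ)
directF-sound (FAC.axiom {φ = φ} ax) = subst (Deriv Ax _ _) (sym (directF-closed φ)) (directF-axiom ax)
directF-sound (FAC.hyp x)            = hyp (∋-map⁺ x)
directF-sound (FAC.⊥E d)             = ⊥E (directF-sound d)
directF-sound (FAC.raa d)            = raa (directF-sound d)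
directF-sound (FAC.⇒I d)             = ⇒I (directF-sound d)
directF-sound (FAC.⇒E d e)           = ⇒E (directF-sound d) (directF-sound e)
directF-sound (FAC.∧I d e)           = ∧I (directF-sound d) (directF-sound e)
directF-sound (FAC.∧E₁ d)            = ∧E₁ (directF-sound d)
directF-sound (FAC.∧E₂ d)            = ∧E₂ (directF-sound d)
directF-sound (FAC.∨I₁ d)            = ∨I₁ (directF-sound d)
directF-sound (FAC.∨I₂ d)            = ∨I₂ (directF-sound d)
directF-sound (FAC.∨E d e f)         = ∨E (directF-sound d) (directF-sound e) (directF-sound f)
directF-sound (FAC.∀I {Δ = Δ} d) =
  ∀I (subst (λ Φ → Deriv Ax _ Φ _) (map-directF-wkF Δ) (directF-sound d))
directF-sound (FAC.∀E {φ = φ} d t) =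
  subst (Deriv Ax _ _) (sym (directF-[] φ t)) (∀E (directF-sound d) (directT t))
directF-sound (FAC.∃I {φ = φ} t d) =
  ∃I (directT t) (subst (Deriv Ax _ _) (directF-[] φ t) (directF-sound d))
directF-sound (FAC.∃E {Δ = Δ} {φ = φ} {ψ = ψ} d e) =
  ∃E (directF-sound d)
     (subst₂ (λ Φ χ → Deriv Ax _ (directF φ ∷ Φ) χ) (map-directF-wkF Δ) (directF-wkF ψ) (directF-sound e))
directF-sound (FAC.≐refl t)          = ≐refl (directT t)
directF-sound (FAC.≐subst {t = t} {u = u} φ d e) =
  subst (Deriv Ax _ _) (sym (directF-[] φ u))
    (≐subst (directF φ) (directF-sound d) (subst (Deriv Ax _ _) (directF-[] φ t) (directF-sound e)))
directF-sound (FAC.nonempty s)       = nonempty (trSort s)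

-- Stated under any renaming because trTerm t occurs renamed inside trTerms, whose layout
-- dom ∧ (trTerm t₁ ∧ (dom ∧ (trTerm t₂ ∧ ⊤'))) the projections below follow.
trTerm⇒≐ : ∀ {Γ s} (t : FAC.Term Γ s) {Θ Δ} (ρ : Ren (trSort s ∷ bl Γ) Θ)
  → Deriv Ax Θ Δ (renF ρ (trTerm t) ⇒ var (ρ here) ≐ renT (λ x → ρ (there x)) (directT t))
trTerm⇒≐ (FAC.var x) ρ = ⇒I (∧E₁ (hyp here))
trTerm⇒≐ (FAC.app ∅f FAC.[]) ρ = ⇒I (∧E₂ (hyp here))
trTerm⇒≐ (FAC.app sing (t FAC.∷ FAC.[])) ρ =
  ⇒I (ex-elim-at (renT (λ x → ρ (there x)) (directT t)) (hyp here)
        (⇒I (⇒E (trTerm⇒≐ t _) (subst (Deriv Ax _ _) (renF-∘₃ (trTerm t)) (∧E₁ (∧E₂ (∧E₁ (hyp here)))))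
             ⟫ ≡⇒≐ (sym (renT-∘ (directT t)))))
        (⇒I (∧E₂ (hyp here))))
trTerm⇒≐ (FAC.app frege (t FAC.∷ FAC.[])) ρ =
  ⇒I (ex-elim-at (renT (λ x → ρ (there x)) (directT t)) (hyp here)
        (⇒I (⇒E (trTerm⇒≐ t _) (subst (Deriv Ax _ _) (renF-∘₃ (trTerm t)) (∧E₁ (∧E₂ (∧E₁ (hyp here)))))
             ⟫ ≡⇒≐ (sym (renT-∘ (directT t)))))
        (⇒I (∧E₂ (hyp here))))
trTerm⇒≐ (FAC.app uni (t₁ FAC.∷ (t₂ FAC.∷ FAC.[]))) ρ =
  ⇒I (ex₂-elim-at (renT (λ x → ρ (there x)) (directT t₁)) (renT (λ x → ρ (there x)) (directT t₂)) (hyp here)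
        (⇒I (⇒E (trTerm⇒≐ t₁ _) (subst (Deriv Ax _ _) (renF-∘₃ (trTerm t₁)) (∧E₁ (∧E₂ (∧E₁ (hyp here)))))
             ⟫ ≡⇒≐ (sym (renT-∘₃ (directT t₁)))))
        (⇒I (⇒E (trTerm⇒≐ t₂ _) (subst (Deriv Ax _ _) (trans (renF-∘₃ _) (renF-∘ (trTerm t₂)))
                                   (∧E₁ (∧E₂ (∧E₂ (∧E₂ (∧E₁ (hyp here)))))))
             ⟫ ≡⇒≐ (sym (renT-∘₃ (directT t₂)))))
        (⇒I (∧E₂ (hyp here))))

≐⇒trTerm : ∀ {Γ s} (t : FAC.Term Γ s) {Θ Δ} (ρ : Ren (trSort s ∷ bl Γ) Θ)
  → Deriv Ax Θ Δ (var (ρ here) ≐ renT (λ x → ρ (there x)) (directT t) ⇒ renF ρ (trTerm t))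
≐⇒trTerm (FAC.var x) ρ = ⇒I (∧I (hyp here) (⇒I (hyp here)))
≐⇒trTerm (FAC.app ∅f FAC.[]) ρ = ⇒I (∧I (⇒I (hyp here)) (hyp here))
≐⇒trTerm (FAC.app sing (t FAC.∷ FAC.[])) ρ =
  ⇒I (ex-intro-at {ψ = var (there (ρ here)) ≐ [ v0 ]} (renT (λ x → ρ (there x)) (directT t)) (hyp here)
        (⇒I (⇒I (∧I (∧I (≐refl v0)
                        (∧I (subst (Deriv Ax _ _) (sym (renF-∘₃ (trTerm t)))
                               (⇒E (≐⇒trTerm t _) (hyp (there here) ⟫ ≡⇒≐ (renT-∘ (directT t)))))
                            (⇒I (hyp here))))
                    (hyp here)))))
≐⇒trTerm (FAC.app frege (t FAC.∷ FAC.[])) ρ =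
  ⇒I (ex-intro-at {ψ = var (there (ρ here)) ≐ F v0} (renT (λ x → ρ (there x)) (directT t)) (hyp here)
        (⇒I (⇒I (∧I (∧I (≐refl v0)
                        (∧I (subst (Deriv Ax _ _) (sym (renF-∘₃ (trTerm t)))
                               (⇒E (≐⇒trTerm t _) (hyp (there here) ⟫ ≡⇒≐ (renT-∘ (directT t)))))
                            (⇒I (hyp here))))
                    (hyp here)))))
≐⇒trTerm (FAC.app uni (t₁ FAC.∷ (t₂ FAC.∷ FAC.[]))) ρ =
  ⇒I (ex₂-intro-at {ψ = var (there (there (ρ here))) ≐ v0 ⋆ v1}
        (renT (λ x → ρ (there x)) (directT t₁)) (renT (λ x → ρ (there x)) (directT t₂)) (hyp here)
        (⇒I (⇒I (⇒I (∧I (∧I (≐refl v0)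
          (∧I (subst (Deriv Ax _ _) (sym (renF-∘₃ (trTerm t₁)))
                 (⇒E (≐⇒trTerm t₁ _) (hyp (there (there here)) ⟫ ≡⇒≐ (renT-∘₃ (directT t₁)))))
          (∧I (≐refl v1)
          (∧I (subst (Deriv Ax _ _) (sym (trans (renF-∘₃ _) (renF-∘ (trTerm t₂))))
                 (⇒E (≐⇒trTerm t₂ _) (hyp (there here) ⟫ ≡⇒≐ (renT-∘₃ (directT t₂)))))
              (⇒I (hyp here))))))
          (hyp here))))))

trAtom⇒directAtom : ∀ {Γ Δ s₁ s₂} (t₁ : FAC.Term Γ s₁) (t₂ : FAC.Term Γ s₂)
  (ψ : Formula (trSort s₁ ∷ trSort s₂ ∷ []))
  → Deriv Ax (bl Γ) Δ (∃* (bl (s₁ ∷ s₂ ∷ [])) (trTerms (t₁ FAC.∷ (t₂ FAC.∷ FAC.[])) ∧ renF inl ψ)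
                       ⇒ subF (directT t₁ ∷ₛ directT t₂ ∷ₛ var) (renF inl ψ))
trAtom⇒directAtom t₁ t₂ ψ =
  ⇒I (ex₂-elim-at (directT t₁) (directT t₂) (hyp here)
        (⇒I (⇒E (trTerm⇒≐ t₁ _) (∧E₁ (∧E₂ (∧E₁ (hyp here)))) ⟫ ≡⇒≐ (sym (renT-∘ (directT t₁)))))
        (⇒I (⇒E (trTerm⇒≐ t₂ _) (subst (Deriv Ax _ _) (renF-∘ (trTerm t₂)) (∧E₁ (∧E₂ (∧E₂ (∧E₂ (∧E₁ (hyp here)))))))
             ⟫ ≡⇒≐ (sym (renT-∘ (directT t₂)))))
        (⇒I (∧E₂ (hyp here))))

directAtom⇒trAtom : ∀ {Γ Δ s₁ s₂} (t₁ : FAC.Term Γ s₁) (t₂ : FAC.Term Γ s₂)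
  (ψ : Formula (trSort s₁ ∷ trSort s₂ ∷ []))
  → Deriv Ax (bl Γ) Δ (subF (directT t₁ ∷ₛ directT t₂ ∷ₛ var) (renF inl ψ)
                       ⇒ ∃* (bl (s₁ ∷ s₂ ∷ [])) (trTerms (t₁ FAC.∷ (t₂ FAC.∷ FAC.[])) ∧ renF inl ψ))
directAtom⇒trAtom t₁ t₂ ψ =
  ⇒I (ex₂-intro-at (directT t₁) (directT t₂) (hyp here)
        (⇒I (⇒I (⇒I (∧I (∧I (≐refl v0)
           (∧I (⇒E (≐⇒trTerm t₁ _) (hyp (there (there here)) ⟫ ≡⇒≐ (renT-∘ (directT t₁))))
           (∧I (≐refl v1)
           (∧I (subst (Deriv Ax _ _) (sym (renF-∘ (trTerm t₂)))
                  (⇒E (≐⇒trTerm t₂ _) (hyp (there here) ⟫ ≡⇒≐ (renT-∘ (directT t₂)))))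
               (⇒I (hyp here))))))
           (hyp here))))))

mutual
  trF⇒directF : ∀ {Γ} (φ : FAC.Formula Γ) {Δ} → Deriv Ax (bl Γ) Δ (trF φ ⇒ directF φ)
  trF⇒directF FAC.⊥' = ⇒I (hyp here)
  trF⇒directF (φ FAC.⇒ ψ) =
    ⇒I (⇒I (⇒E (trF⇒directF ψ) (⇒E (hyp (there here)) (⇒E (directF⇒trF φ) (hyp here)))))
  trF⇒directF (φ FAC.∧ ψ) =
    ⇒I (∧I (⇒E (trF⇒directF φ) (∧E₁ (hyp here))) (⇒E (trF⇒directF ψ) (∧E₂ (hyp here))))
  trF⇒directF (φ FAC.∨ ψ) =
    ⇒I (∨E (hyp here) (∨I₁ (⇒E (trF⇒directF φ) (hyp here))) (∨I₂ (⇒E (trF⇒directF ψ) (hyp here))))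
  trF⇒directF (FAC.all s φ) =
    ⇒I (∀I (⇒E (trF⇒directF φ)
      (subst (Deriv Ax _ _) (liftWk-[v0] (trF φ)) (⇒E (∀E (hyp here) v0) (≐refl v0)))))
  trF⇒directF (FAC.ex s φ) =
    ⇒I (∃E (hyp here) (∃I v0
      (subst (Deriv Ax _ _) (sym (liftWk-[v0] (directF φ))) (⇒E (trF⇒directF φ) (∧E₂ (hyp here))))))
  trF⇒directF (t FAC.≐ u) = trAtom⇒directAtom t u (v0 ≐ v1)
  trF⇒directF (FAC.rel mem (x FAC.∷ (X FAC.∷ FAC.[]))) = trAtom⇒directAtom x X (v0 occurs-in v1)

  directF⇒trF : ∀ {Γ} (φ : FAC.Formula Γ) {Δ} → Deriv Ax (bl Γ) Δ (directF φ ⇒ trF φ)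
  directF⇒trF FAC.⊥' = ⇒I (hyp here)
  directF⇒trF (φ FAC.⇒ ψ) =
    ⇒I (⇒I (⇒E (directF⇒trF ψ) (⇒E (hyp (there here)) (⇒E (trF⇒directF φ) (hyp here)))))
  directF⇒trF (φ FAC.∧ ψ) =
    ⇒I (∧I (⇒E (directF⇒trF φ) (∧E₁ (hyp here))) (⇒E (directF⇒trF ψ) (∧E₂ (hyp here))))
  directF⇒trF (φ FAC.∨ ψ) =
    ⇒I (∨E (hyp here) (∨I₁ (⇒E (directF⇒trF φ) (hyp here))) (∨I₂ (⇒E (directF⇒trF ψ) (hyp here))))
  directF⇒trF (FAC.all s φ) =
    ⇒I (∀I (⇒I (⇒E (directF⇒trF φ)
      (subst (Deriv Ax _ _) (liftWk-[v0] (directF φ)) (∀E (hyp (there here)) v0)))))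
  directF⇒trF (FAC.ex s φ) =
    ⇒I (∃E (hyp here) (∃I v0 (subst (Deriv Ax _ _) (sym (liftWk-[v0] (v0 ≐ v0 ∧ trF φ)))
      (∧I (≐refl v0) (⇒E (directF⇒trF φ) (hyp here))))))
  directF⇒trF (t FAC.≐ u) = directAtom⇒trAtom t u (v0 ≐ v1)
  directF⇒trF (FAC.rel mem (x FAC.∷ (X FAC.∷ FAC.[]))) = directAtom⇒trAtom x X (v0 occurs-in v1)

mainTheorem2 : ODirectlyInterprets-FUTC-FAC
mainTheorem2 = τ , τ-oDirect , λ ψ d → ⇒E (directF⇒trF ψ) (directF-sound d)
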